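{- Let $\mathcal{G}$ be a class of graphs, let $t\ge 0$ be an integer, and let $U$ be a graph containing every graph in $\mathcal{G}^{+t}$ as a subgraph. Then $U$ contains a subgraph $U'$ which contains at least $|\mathcal{G}|/\binom{|V(U)|}{t}$ graphs of $\mathcal{G}$ as subgraphs, together with a clique on $t$ vertices in $U-V(U')$ every vertex of which is adjacent to all vertices of $U'$.
   Context: Graphs are unlabelled (considered up to isomorphism); $|\mathcal{G}|$ is the number of isomorphism classes in $\mathcal{G}$. For a graph $G$, $G^{+t}$ is the graph obtained from $G$ by adding $t$ new vertices that form a clique and are adjacent to all vertices of $G$, and $\mathcal{G}^{+t}=\{G^{+t}:G\in\mathcal{G}\}$. "$U$ contains $H$ as a subgraph" means $U$ has a subgraph isomorphic to $H$. -}

module Defs where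

open import Data.Nat using (ℕ; _+_)
open import Data.Fin using (Fin; splitAt; _≟_)
open import Data.Bool using (Bool; true; false; not)
open import Data.Sum using (_⊎_; inj₁; inj₂)
open import Data.Product using (Σ; _×_; _,_; proj₁)
open import Relation.Nullary using (¬_; yes; no)
open import Relation.Nullary.Decidable using (isYes)
open import Relation.Binary.PropositionalEquality using (_≡_; _≢_; refl; sym)
open import Function.Definitions using (Injective)

record Graph : Set where
  field
    size       : ℕ
    adj        : Fin size → Fin size → Bool
    adj-sym    : ∀ i j → adj i j ≡ adj j i
    adj-irrefl : ∀ i → adj i i ≡ false
open Graph public

V : Graph → Set
V G = Fin (size G)

_⊑_ : Graph → Graph → Set
H ⊑ G = Σ (V H → V G) λ f →
          Injective _≡_ _≡_ f × (∀ i j → adj H i j ≡ true → adj G (f i) (f j) ≡ true)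

emb : ∀ {H G} → H ⊑ G → V H → V G
emb e = proj₁ e

_≅_ : Graph → Graph → Set
G ≅ H = Σ (V G → V H) λ f → Σ (V H → V G) λ g →
          (∀ x → g (f x) ≡ x) × (∀ y → f (g y) ≡ y) ×
          (∀ i j → adj H (f i) (f j) ≡ adj G i j)

-- G^{+t}: vertices of G are Fin n (first block), new vertices are Fin t (second block).
plusAdj : (G : Graph) (t : ℕ) → Fin (size G + t) → Fin (size G + t) → Bool
plusAdj G t i j with splitAt (size G) i | splitAt (size G) j
... | inj₁ a | inj₁ b = adj G a b
... | inj₂ a | inj₂ b = not (isYes (a ≟ b))
... | inj₁ _ | inj₂ _ = true
... | inj₂ _ | inj₁ _ = true

plusAdj-sym : ∀ G t i j → plusAdj G t i j ≡ plusAdj G t j i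
plusAdj-sym G t i j with splitAt (size G) i | splitAt (size G) j
... | inj₁ a | inj₁ b = adj-sym G a b
... | inj₂ a | inj₂ b with a ≟ b | b ≟ a
...   | yes _ | yes _ = refl
...   | no _  | no _  = refl
...   | yes p | no q  = Data.Empty.⊥-elim (q (sym p)) where import Data.Empty
...   | no q  | yes p = Data.Empty.⊥-elim (q (sym p)) where import Data.Empty
plusAdj-sym G t i j | inj₁ _ | inj₂ _ = refl
plusAdj-sym G t i j | inj₂ _ | inj₁ _ = refl

plusAdj-irrefl : ∀ G t i → plusAdj G t i i ≡ false
plusAdj-irrefl G t i with splitAt (size G) i
... | inj₁ a = adj-irrefl G a
... | inj₂ a with a ≟ a
...   | yes _ = refl
...   | no q  = Data.Empty.⊥-elim (q refl) where import Data.Empty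

_⁺_ : Graph → ℕ → Graph
G ⁺ t = record
  { size = size G + t
  ; adj = plusAdj G t
  ; adj-sym = plusAdj-sym G t
  ; adj-irrefl = plusAdj-irrefl G t }

JoinedClique : (U : Graph) (t : ℕ) (W : Graph) → W ⊑ U → Set
JoinedClique U t W e = Σ (Fin t → V U) λ c →
  Injective _≡_ _≡_ c ×
  (∀ i j → i ≢ j → adj U (c i) (c j) ≡ true) ×
  (∀ i w → c i ≢ emb {W} {U} e w) ×
  (∀ i w → adj U (c i) (emb {W} {U} e w) ≡ true)

-- Fix, for every G in 𝒢, an embedding of G⁺ᵗ into U. The images of the t new vertices form a
-- t-subset of V(U), its apex set, and there are only (|V(U)| choose t) such subsets; by pigeonhole
-- one subset S is the apex set for at least a 1/(|V(U)| choose t) fraction of the list 𝒢. Every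
-- such G embeds into the subgraph U′ of U induced on the common neighbours of S outside S, and S,
-- listed by any one of these embeddings, is the required clique. The graphs of 𝒢 need not be
-- pairwise non-isomorphic for this count.

module Submission where

open import Defs
open import Data.Nat using (ℕ; _≤_; _*_)
open import Data.Nat.Combinatorics using (_C_)
open import Data.List using (List; []; length)
open import Data.List.Relation.Unary.All using (All)
open import Data.List.Relation.Unary.AllPairs using (AllPairs)
open import Data.List.Relation.Unary.AllPairs using (_∷_)
open import Data.List.Relation.Binary.Sublist.Propositional using (_⊆_)
open import Data.Product using (Σ; _×_)
open import Relation.Nullary using (¬_)
open import Relation.Binary.PropositionalEquality using (_≢_)

open import Data.Nat using (zero; suc; _+_; z≤n; _≤?_)
open import Data.Nat.Properties using (module ≤-Reasoning; ≤-refl; ≤-reflexive; ≤-trans; ≰⇒≥; +-mono-≤; +-monoʳ-≤; *-monoˡ-≤; *-suc; +-suc)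
open import Data.Nat.Combinatorics using (nCk+nC[k+1]≡[n+1]C[k+1])
open import Data.Bool using (true)
open import Data.Fin using (Fin; zero; suc; _↑ˡ_; _↑ʳ_; splitAt; _≟_)
open import Data.Fin.Properties using (splitAt-↑ˡ; splitAt-↑ʳ; ↑ˡ-injective; ↑ʳ-injective; suc-injective; all?)
open import Data.Fin.Subset using (Subset; inside; outside; ⁅_⁆; _∪_; ∣_∣)
  renaming (_∈_ to _∈ₛ_; _∉_ to _∉ₛ_; ⊥ to ∅)
open import Data.Fin.Subset.Properties using (_∈?_; ∉⊥; ∣⊥∣≡0; x∈⁅x⁆; x∈⁅y⁆⇒x≡y; x∈p∪q⁺; x∈p∪q⁻; ∪-identityˡ; drop-not-there)
open import Data.Vec using ([]; _∷_; here)
open import Data.List using (_∷_; _++_; map; filter; lookup; allFin)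
open import Data.List.Properties using (length-++; length-map)
open import Data.List.Relation.Unary.All using ([]; _∷_)
import Data.List.Relation.Unary.All as All
open import Data.List.Relation.Unary.All.Properties using (all-filter)
open import Data.List.Relation.Unary.Any using (Any; here; there; index)
open import Data.List.Relation.Unary.Any.Properties using (lookup-index)
open import Data.List.Relation.Unary.Unique.Propositional using (Unique)
open import Data.List.Relation.Unary.Unique.Propositional.Properties using (allFin⁺; filter⁺)
open import Data.List.Membership.Propositional using (_∈_; lose)
open import Data.List.Membership.Propositional.Properties using (∈-++⁺ˡ; ∈-++⁺ʳ; ∈-map⁺; ∈-lookup; ∈-filter⁺; ∈-allFin)
open import Data.List.Relation.Binary.Sublist.Propositional using ([]; _∷_; _∷ʳ_; ⊆-trans)
open import Data.Product using (_,_; proj₁; proj₂; ∃)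
open import Data.Sum using (inj₁; inj₂)
open import Data.Empty using (⊥-elim)
open import Function using (_∘_; id)
open import Function.Definitions using (Injective)
open import Relation.Nullary using (yes; no; contradiction)
open import Relation.Nullary.Decidable using (¬?; _×-dec_; _→-dec_)
open import Relation.Unary using (Decidable)
open import Relation.Binary.PropositionalEquality using (_≡_; refl; sym; trans; cong; cong₂; subst; module ≡-Reasoning)
import Data.Bool as Bool

image : ∀ {t n} → (Fin t → Fin n) → Subset n
image {zero}  c = ∅
image {suc t} c = ⁅ c zero ⁆ ∪ image (c ∘ suc)

∈-image : ∀ {t n} (c : Fin t → Fin n) i → c i ∈ₛ image c
∈-image c zero    = x∈p∪q⁺ (inj₁ (x∈⁅x⁆ (c zero)))
∈-image c (suc i) = x∈p∪q⁺ (inj₂ (∈-image (c ∘ suc) i))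

∈-image⁻ : ∀ {t n} (c : Fin t → Fin n) {v} → v ∈ₛ image c → ∃ λ i → c i ≡ v
∈-image⁻ {zero}  c v∈ = ⊥-elim (∉⊥ v∈)
∈-image⁻ {suc t} c v∈ with x∈p∪q⁻ ⁅ c zero ⁆ (image (c ∘ suc)) v∈
... | inj₁ v∈⁅c0⁆ = zero , sym (x∈⁅y⁆⇒x≡y (c zero) v∈⁅c0⁆)
... | inj₂ v∈rest = let i , ci≡v = ∈-image⁻ (c ∘ suc) v∈rest in suc i , ci≡v

∣⁅x⁆∪p∣≡1+∣p∣ : ∀ {n} {x : Fin n} (p : Subset n) → x ∉ₛ p → ∣ ⁅ x ⁆ ∪ p ∣ ≡ suc ∣ p ∣
∣⁅x⁆∪p∣≡1+∣p∣ {x = zero}  (inside  ∷ p) x∉p = contradiction here x∉p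
∣⁅x⁆∪p∣≡1+∣p∣ {x = zero}  (outside ∷ p) x∉p = cong (suc ∘ ∣_∣) (∪-identityˡ p)
∣⁅x⁆∪p∣≡1+∣p∣ {x = suc x} (inside  ∷ p) x∉p = cong suc (∣⁅x⁆∪p∣≡1+∣p∣ p (drop-not-there x∉p))
∣⁅x⁆∪p∣≡1+∣p∣ {x = suc x} (outside ∷ p) x∉p = ∣⁅x⁆∪p∣≡1+∣p∣ p (drop-not-there x∉p)

∣image∣≡t : ∀ {t n} (c : Fin t → Fin n) → Injective _≡_ _≡_ c → ∣ image c ∣ ≡ t
∣image∣≡t {zero} {n} c _ = ∣⊥∣≡0 n
∣image∣≡t {suc t} c c-inj =
  trans (∣⁅x⁆∪p∣≡1+∣p∣ (image (c ∘ suc)) c0∉rest)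
        (cong suc (∣image∣≡t (c ∘ suc) (suc-injective ∘ c-inj)))
  where
  c0∉rest : c zero ∉ₛ image (c ∘ suc)
  c0∉rest c0∈ with ∈-image⁻ (c ∘ suc) c0∈
  ... | i , eq with c-inj eq
  ... | ()

subsetsOfSize : (n k : ℕ) → List (Subset n)
subsetsOfSize zero    zero    = [] ∷ []
subsetsOfSize zero    (suc k) = []
subsetsOfSize (suc n) zero    = map (outside ∷_) (subsetsOfSize n zero)
subsetsOfSize (suc n) (suc k) =
  map (inside ∷_) (subsetsOfSize n k) ++ map (outside ∷_) (subsetsOfSize n (suc k))

length-subsetsOfSize : ∀ n k → length (subsetsOfSize n k) ≡ n C k
length-subsetsOfSize zero    zero    = refl
length-subsetsOfSize zero    (suc k) = refl
length-subsetsOfSize (suc n) zero    =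
  trans (length-map _ (subsetsOfSize n zero)) (length-subsetsOfSize n zero)
length-subsetsOfSize (suc n) (suc k) = begin
  length (map (inside ∷_) withN ++ map (outside ∷_) withoutN)
    ≡⟨ length-++ (map (inside ∷_) withN) ⟩
  length (map (inside ∷_) withN) + length (map (outside ∷_) withoutN)
    ≡⟨ cong₂ _+_ (length-map _ withN) (length-map _ withoutN) ⟩
  length withN + length withoutN
    ≡⟨ cong₂ _+_ (length-subsetsOfSize n k) (length-subsetsOfSize n (suc k)) ⟩
  n C k + n C suc k
    ≡⟨ nCk+nC[k+1]≡[n+1]C[k+1] n k ⟩
  suc n C suc k ∎
  where
  open ≡-Reasoning
  withN withoutN : List (Subset n)
  withN    = subsetsOfSize n k
  withoutN = subsetsOfSize n (suc k)

∈-subsetsOfSize : ∀ {n} (p : Subset n) → p ∈ subsetsOfSize n ∣ p ∣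
∈-subsetsOfSize []            = here refl
∈-subsetsOfSize (inside ∷ p)  = ∈-++⁺ˡ (∈-map⁺ (inside ∷_) (∈-subsetsOfSize p))
∈-subsetsOfSize (outside ∷ p) with ∣ p ∣ | ∈-subsetsOfSize p
... | zero  | p∈ = ∈-map⁺ (outside ∷_) p∈
... | suc k | p∈ = ∈-++⁺ʳ _ (∈-map⁺ (outside ∷_) p∈)

+-≤-*suc : ∀ {a b l m k} → a ≤ m → b ≤ l * k → l ≤ m → a + b ≤ m * suc k
+-≤-*suc {a} {b} {l} {m} {k} a≤m b≤lk l≤m = begin
  a + b      ≤⟨ +-mono-≤ a≤m b≤lk ⟩
  m + l * k  ≤⟨ +-monoʳ-≤ m (*-monoˡ-≤ k l≤m) ⟩
  m + m * k  ≡⟨ *-suc m k ⟨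
  m * suc k  ∎
  where open ≤-Reasoning

module _ {A B : Set} (K : A → B → Set) where

  partitionByHead : ∀ {c cs xs} → All (λ x → Any (K x) (c ∷ cs)) xs →
    Σ (List A) λ ys → Σ (List A) λ zs →
      ys ⊆ xs × All (λ y → K y c) ys × zs ⊆ xs × All (λ z → Any (K z) cs) zs ×
      length xs ≡ length ys + length zs
  partitionByHead [] = [] , [] , [] , [] , [] , [] , refl
  partitionByHead {xs = x ∷ _} (here k ∷ ps) =
    let ys , zs , ys⊆ , ys-c , zs⊆ , zs-cs , |xs|≡ = partitionByHead ps
    in x ∷ ys , zs , refl ∷ ys⊆ , k ∷ ys-c , x ∷ʳ zs⊆ , zs-cs , cong suc |xs|≡
  partitionByHead {xs = x ∷ _} (there k ∷ ps) =
    let ys , zs , ys⊆ , ys-c , zs⊆ , zs-cs , |xs|≡ = partitionByHead ps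
    in ys , x ∷ zs , x ∷ʳ ys⊆ , ys-c , refl ∷ zs⊆ , k ∷ zs-cs ,
       trans (cong suc |xs|≡) (sym (+-suc (length ys) (length zs)))

  -- The default b₀ is returned only when cs, and hence xs, is empty.
  pigeonhole : (b₀ : B) (cs : List B) {xs : List A} → All (λ x → Any (K x) cs) xs →
    Σ B λ b → Σ (List A) λ L → L ⊆ xs × All (λ x → K x b) L × length xs ≤ length L * length cs
  pigeonhole b₀ []       []           = b₀ , [] , [] , [] , z≤n
  pigeonhole b₀ []       (() ∷ _)
  pigeonhole b₀ (c ∷ cs) ps
    with ys , zs , ys⊆ , ys-c , zs⊆ , zs-cs , |xs|≡ ← partitionByHead ps
    with b , L , L⊆ , L-b , |zs|≤ ← pigeonhole c cs zs-cs
    with length L ≤? length ys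
  ... | yes |L|≤|ys| = c , ys , ys⊆ , ys-c ,
    ≤-trans (≤-reflexive |xs|≡) (+-≤-*suc ≤-refl |zs|≤ |L|≤|ys|)
  ... | no  |L|≰|ys| = b , L , ⊆-trans L⊆ zs⊆ , L-b ,
    ≤-trans (≤-reflexive |xs|≡) (+-≤-*suc (≰⇒≥ |L|≰|ys|) |zs|≤ ≤-refl)

lookup-injective : ∀ {A : Set} {xs : List A} → Unique xs → Injective _≡_ _≡_ (lookup xs)
lookup-injective (_  ∷ _)  {zero}  {zero}  _  = refl
lookup-injective (x∉ ∷ _)  {zero}  {suc j} eq = contradiction eq (All.lookup x∉ (∈-lookup j))
lookup-injective (x∉ ∷ _)  {suc i} {zero}  eq = contradiction (sym eq) (All.lookup x∉ (∈-lookup i))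
lookup-injective (_  ∷ xs!) {suc i} {suc j} eq = cong suc (lookup-injective xs! eq)

⊑-trans : ∀ {F G H} → F ⊑ G → G ⊑ H → F ⊑ H
⊑-trans (f , f-inj , f-adj) (g , g-inj , g-adj) =
  g ∘ f , f-inj ∘ g-inj , λ i j → g-adj (f i) (f j) ∘ f-adj i j

induced : (U : Graph) → List (V U) → Graph
induced U xs = record
  { size       = length xs
  ; adj        = λ i j → adj U (lookup xs i) (lookup xs j)
  ; adj-sym    = λ i j → adj-sym U (lookup xs i) (lookup xs j)
  ; adj-irrefl = λ i → adj-irrefl U (lookup xs i)
  }

induced-⊑ : ∀ {U xs} → Unique xs → induced U xs ⊑ U
induced-⊑ {xs = xs} xs! = lookup xs , lookup-injective xs! , λ _ _ → id

⊑-induced : ∀ {H U xs} (e : H ⊑ U) → (∀ a → emb {H} {U} e a ∈ xs) → H ⊑ induced U xs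
⊑-induced {H} {U} {xs} (f , f-inj , f-adj) f∈ = g , g-inj , g-adj
  where
  g : V H → Fin (length xs)
  g a = index (f∈ a)
  lookup∘g : ∀ a → lookup xs (g a) ≡ f a
  lookup∘g a = sym (lookup-index (f∈ a))
  g-inj : Injective _≡_ _≡_ g
  g-inj {a} {b} ga≡gb =
    f-inj (trans (sym (lookup∘g a)) (trans (cong (lookup xs) ga≡gb) (lookup∘g b)))
  g-adj : ∀ a b → adj H a b ≡ true → adj U (lookup xs (g a)) (lookup xs (g b)) ≡ true
  g-adj a b ab rewrite lookup∘g a | lookup∘g b = f-adj a b ab

CommonNeighbour : (U : Graph) → Subset (size U) → V U → Set
CommonNeighbour U S v = v ∉ₛ S × (∀ u → u ∈ₛ S → adj U u v ≡ true)

commonNeighbour? : ∀ U S → Decidable (CommonNeighbour U S)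
commonNeighbour? U S v = ¬? (v ∈? S) ×-dec all? (λ u → u ∈? S →-dec adj U u v Bool.≟ true)

commonNeighbours : (U : Graph) → Subset (size U) → List (V U)
commonNeighbours U S = filter (commonNeighbour? U S) (allFin (size U))

commonNeighbourhood : (U : Graph) → Subset (size U) → Graph
commonNeighbourhood U S = induced U (commonNeighbours U S)

commonNeighbourhood-⊑ : ∀ U S → commonNeighbourhood U S ⊑ U
commonNeighbourhood-⊑ U S = induced-⊑ {U} (filter⁺ (commonNeighbour? U S) (allFin⁺ (size U)))

commonNeighbourhood-common : ∀ U S w → CommonNeighbour U S (lookup (commonNeighbours U S) w)
commonNeighbourhood-common U S w =
  All.lookup (all-filter (commonNeighbour? U S) (allFin (size U))) (∈-lookup w)

⊑-commonNeighbourhood : ∀ {H U S} (e : H ⊑ U) → (∀ a → CommonNeighbour U S (emb {H} {U} e a)) →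
                        H ⊑ commonNeighbourhood U S
⊑-commonNeighbourhood {H} {U} {S} e common =
  ⊑-induced {H} {U} {commonNeighbours U S} e λ a →
    ∈-filter⁺ (commonNeighbour? U S) (∈-allFin _) (common a)

joinedClique : ∀ {U t} (c : Fin t → V U) → Injective _≡_ _≡_ c →
               (∀ i j → i ≢ j → adj U (c i) (c j) ≡ true) →
               JoinedClique U t (commonNeighbourhood U (image c))
                                (commonNeighbourhood-⊑ U (image c))
joinedClique {U} c c-inj c-clique = c , c-inj , c-clique , distinct , adjacent
  where
  distinct : ∀ i w → c i ≢ lookup (commonNeighbours U (image c)) w
  distinct i w ci≡ =
    proj₁ (commonNeighbourhood-common U (image c) w) (subst (_∈ₛ image c) ci≡ (∈-image c i))
  adjacent : ∀ i w → adj U (c i) (lookup (commonNeighbours U (image c)) w) ≡ true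
  adjacent i w = proj₂ (commonNeighbourhood-common U (image c) w) (c i) (∈-image c i)

↑ʳ≢↑ˡ : ∀ {m n} (i : Fin n) (j : Fin m) → m ↑ʳ i ≢ j ↑ˡ n
↑ʳ≢↑ˡ {m} {n} i j eq
  with () ← trans (sym (splitAt-↑ʳ m n i)) (trans (cong (splitAt m) eq) (splitAt-↑ˡ m j n))

⁺-adj-↑ˡ : ∀ G t a b → adj (G ⁺ t) (a ↑ˡ t) (b ↑ˡ t) ≡ adj G a b
⁺-adj-↑ˡ G t a b rewrite splitAt-↑ˡ (size G) a t | splitAt-↑ˡ (size G) b t = refl

⁺-adj-↑ʳ-↑ˡ : ∀ G t i a → adj (G ⁺ t) (size G ↑ʳ i) (a ↑ˡ t) ≡ true
⁺-adj-↑ʳ-↑ˡ G t i a rewrite splitAt-↑ʳ (size G) t i | splitAt-↑ˡ (size G) a t = refl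

⁺-adj-↑ʳ-↑ʳ : ∀ G t {i j} → i ≢ j → adj (G ⁺ t) (size G ↑ʳ i) (size G ↑ʳ j) ≡ true
⁺-adj-↑ʳ-↑ʳ G t {i} {j} i≢j rewrite splitAt-↑ʳ (size G) t i | splitAt-↑ʳ (size G) t j with i ≟ j
... | yes i≡j = contradiction i≡j i≢j
... | no  _   = refl

⊑-⁺ : ∀ G t → G ⊑ (G ⁺ t)
⊑-⁺ G t = (_↑ˡ t) , ↑ˡ-injective t _ _ , λ a b ab → trans (⁺-adj-↑ˡ G t a b) ab

module Apex {G U : Graph} {t : ℕ} (e : (G ⁺ t) ⊑ U) where

  apices : Fin t → V U
  apices i = emb {G ⁺ t} {U} e (size G ↑ʳ i)

  apices-injective : Injective _≡_ _≡_ apices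
  apices-injective eq = ↑ʳ-injective (size G) _ _ (proj₁ (proj₂ e) eq)

  apices-adjacent : ∀ i j → i ≢ j → adj U (apices i) (apices j) ≡ true
  apices-adjacent i j i≢j = proj₂ (proj₂ e) _ _ (⁺-adj-↑ʳ-↑ʳ G t i≢j)

  base : G ⊑ U
  base = ⊑-trans {G} {G ⁺ t} {U} (⊑-⁺ G t) e

  base-commonNeighbour : ∀ a → CommonNeighbour U (image apices) (emb {G} {U} base a)
  base-commonNeighbour a = notApex , adjacent
    where
    notApex : emb {G} {U} base a ∉ₛ image apices
    notApex a∈ = let i , apex≡base = ∈-image⁻ apices a∈
                 in ↑ʳ≢↑ˡ i a (proj₁ (proj₂ e) apex≡base)
    adjacent : ∀ u → u ∈ₛ image apices → adj U u (emb {G} {U} base a) ≡ true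
    adjacent u u∈ = let i , apex≡u = ∈-image⁻ apices u∈
                    in subst (λ x → adj U x _ ≡ true) apex≡u
                             (proj₂ (proj₂ e) _ _ (⁺-adj-↑ʳ-↑ˡ G t i a))

  ⊑-commonNeighbourhood-apices : G ⊑ commonNeighbourhood U (image apices)
  ⊑-commonNeighbourhood-apices = ⊑-commonNeighbourhood {G} {U} base base-commonNeighbour

HasApexSet : (U : Graph) (t : ℕ) → Graph → Subset (size U) → Set
HasApexSet U t G S = Σ ((G ⁺ t) ⊑ U) λ e → image (Apex.apices {G} {U} {t} e) ≡ S

apexSet-candidate : ∀ U t {G} → (G ⁺ t) ⊑ U → Any (HasApexSet U t G) (subsetsOfSize (size U) t)
apexSet-candidate U t {G} e =
  lose (subst (λ k → image apices ∈ subsetsOfSize (size U) k) (∣image∣≡t apices apices-injective)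
              (∈-subsetsOfSize (image apices)))
       (e , refl)
  where open Apex {G} {U} {t} e

lemma4p5 : (𝒢 : List Graph) → AllPairs (λ G H → ¬ (G ≅ H)) 𝒢 → 𝒢 ≢ [] →
           (t : ℕ) (U : Graph) → All (λ G → (G ⁺ t) ⊑ U) 𝒢 →
           Σ Graph λ U′ → Σ (U′ ⊑ U) λ e →
             (Σ (List Graph) λ L → L ⊆ 𝒢 × All (λ G → G ⊑ U′) L ×
                length 𝒢 ≤ length L * (size U C t))
             × JoinedClique U t U′ e
lemma4p5 [] _ []≢[] _ _ _ = ⊥-elim ([]≢[] refl)
lemma4p5 𝒢@(_ ∷ _) _ _ t U embeds
  with pigeonhole (HasApexSet U t) ∅ (subsetsOfSize (size U) t)
                  (All.map (apexSet-candidate U t) embeds)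
... | _ , [] , _ , _ , ()
... | _ , G₀ ∷ L , L⊆𝒢 , (e₀ , refl) ∷ L-apices , large =
  commonNeighbourhood U S , commonNeighbourhood-⊑ U S ,
  (G₀ ∷ L , L⊆𝒢 , All.map embedsInto ((e₀ , refl) ∷ L-apices) ,
   subst (λ k → length 𝒢 ≤ length (G₀ ∷ L) * k) (length-subsetsOfSize (size U) t) large) ,
  joinedClique {U} apices apices-injective apices-adjacent
  where
  open Apex {G₀} {U} {t} e₀
  S : Subset (size U)
  S = image apices
  embedsInto : ∀ {G} → HasApexSet U t G S → G ⊑ commonNeighbourhood U S
  embedsInto {G} (e , apices≡) =
    subst (λ S′ → G ⊑ commonNeighbourhood U S′) apices≡
          (Apex.⊑-commonNeighbourhood-apices {G} {U} {t} e)
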